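{- Let $a,b,q$ be indeterminates. For every nonempty partition $\mu$, \[ (1-q^{|\mu|})Z_{\mu}(a,b,q)=\sum_{i:\ m_i(\mu)\neq0}(a^iq^{|\mu|-i}-b^i)\,Z_{\mu\setminus\{i\}}(a,b,q), \] where $Z_\emptyset=1$.
   Context: For a partition $\mu$ of length $l$, $C_\mu$ is the set of distinct sequences $c=(c_1,\ldots,c_l)$ obtained by permuting the parts of $\mu$, $[c_i]=c_1+\cdots+c_i$, $[c_0]=0$, and $Z_{\mu}(a,b,q)=\sum_{c\in C_{\mu}}\prod_{i=1}^{l}\frac{a^{c_i}q^{[c_{i-1}]}-b^{c_i}}{1-q^{[c_i]}}$. $m_i(\mu)$ is the multiplicity of $i$ in $\mu$, $|\mu|$ the sum of parts, and $\mu\setminus\{i\}$ is the partition obtained from $\mu$ by removing one part equal to $i$. -}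

module Defs where

open import Level using (Level)
open import Data.Nat as ℕ using (ℕ; zero; suc; _≥_; _≤_)
open import Data.Nat.Properties using () renaming (_≟_ to _≟ℕ_)
open import Data.List using (List; []; _∷_; map; concatMap; foldr; deduplicate)
open import Data.Nat.ListAction using (sum)
open import Data.List.Properties using (≡-dec)
open import Data.List.Relation.Unary.All using (All)
open import Data.List.Relation.Unary.Linked using (Linked)
open import Relation.Nullary using (yes; no)
open import Algebra.Bundles using (CommutativeRing)

IsPartition : List ℕ → Set
IsPartition μ = All (λ x → 1 ≤ x) μ × Linked _≥_ μ
  where open import Data.Product using (_×_)

size : List ℕ → ℕ
size = sum

insertions : ℕ → List ℕ → List (List ℕ)
insertions x [] = (x ∷ []) ∷ []
insertions x (y ∷ ys) = (x ∷ y ∷ ys) ∷ map (y ∷_) (insertions x ys)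

permutations : List ℕ → List (List ℕ)
permutations [] = [] ∷ []
permutations (x ∷ xs) = concatMap (insertions x) (permutations xs)

C : List ℕ → List (List ℕ)
C μ = deduplicate (≡-dec _≟ℕ_) (permutations μ)

-- the distinct parts i of μ (those with m_i(μ) ≠ 0)
distinctParts : List ℕ → List ℕ
distinctParts = deduplicate _≟ℕ_

removeOne : ℕ → List ℕ → List ℕ
removeOne i [] = []
removeOne i (x ∷ xs) with i ≟ℕ x
... | yes _ = xs
... | no  _ = x ∷ removeOne i xs

module WithRing {c ℓ} (R : CommutativeRing c ℓ) where
  open CommutativeRing R

  pow : Carrier → ℕ → Carrier
  pow x zero = 1#
  pow x (suc n) = x * pow x n

  Σ : List Carrier → Carrier
  Σ = foldr _+_ 0#

  -- Parameters: a b q, and inv k playing the role of 1/(1 - q^k).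
  module Z (a b q : Carrier) (inv : ℕ → Carrier) where
    -- ∏_{i} (a^{c_i} q^{[c_{i-1}]} - b^{c_i}) / (1 - q^{[c_i]}),
    -- s = [c_{i-1}] is the running prefix sum
    term : ℕ → List ℕ → Carrier
    term s [] = 1#
    term s (x ∷ xs) =
      ((pow a x * pow q s) - pow b x) * inv (s ℕ.+ x) * term (s ℕ.+ x) xs

    -- Z_μ(a,b,q); note C [] = [ [] ], so Z_∅ = 1
    Zμ : List ℕ → Carrier
    Zμ μ = Σ (map (term 0) (C μ))

-- Sort the sequences c ∈ C_μ by their last entry i.  Removing it leaves exactly the
-- sequences of C_{μ∖{i}}, and since the prefix sum before the last entry is |μ| − i,
-- the last factor of the product is (a^i q^{|μ|−i} − b^i) / (1 − q^{|μ|}) for every c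
-- ending in i.  Hence Z_μ = Σ_i Z_{μ∖{i}} (a^i q^{|μ|−i} − b^i) / (1 − q^{|μ|}), and
-- multiplying by 1 − q^{|μ|} cancels the common denominator.
module Submission where

open import Defs
open import Data.Nat using (ℕ; _≤_)
open import Algebra.Bundles using (CommutativeRing)
import Data.Nat as ℕ
import Data.Nat.Properties as ℕ
open import Data.Nat.ListAction using (sum)
open import Data.Nat.ListAction.Properties using (sum-↭)
open import Data.List using (List; []; _∷_; map; _++_; _∷ʳ_; concatMap; initLast; _∷ʳ′_)
open import Data.List.Properties using (≡-dec; ∷ʳ-injectiveˡ; ∷ʳ-injectiveʳ; map-∘)
open import Data.List.Membership.Propositional using (_∈_; find; lose)
open import Data.List.Membership.Propositional.Properties
  using (∈-map⁺; ∈-map⁻; ∈-∃++; ∈-concatMap⁺; ∈-concatMap⁻; ∈-deduplicate⁻; ∈-deduplicate⁺)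
open import Data.List.Membership.Propositional.Properties.WithK using (unique∧set⇒bag)
open import Data.List.Relation.Binary.BagAndSetEquality using (∼bag⇒↭)
open import Data.List.Relation.Binary.Permutation.Propositional
  using (_↭_; prep; swap; ↭-refl; ↭-sym; ↭-trans; ↭⇒↭ₛ′)
open import Data.List.Relation.Binary.Permutation.Propositional.Properties
  using (∈-resp-↭; drop-mid; drop-∷; ∷↭∷ʳ; ↭-empty-inv; map⁺)
import Data.List.Relation.Binary.Permutation.Setoid.Properties as SetoidPermutation
open import Data.List.Relation.Unary.Any using (here; there)
open import Data.List.Relation.Unary.All using (_∷_)
import Data.List.Relation.Unary.All as All
open import Data.List.Relation.Unary.AllPairs using ([]; _∷_)
open import Data.List.Relation.Unary.Unique.Propositional using (Unique)
import Data.List.Relation.Unary.Unique.Propositional.Properties as Unique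
import Data.List.Relation.Unary.Unique.DecPropositional.Properties as DecUnique
open import Data.Product using (_×_; ∃₂; _,_; proj₁)
open import Data.Empty using (⊥; ⊥-elim)
open import Function.Bundles using (mk⇔)
open import Relation.Nullary using (yes; no)
open import Relation.Binary.PropositionalEquality using (_≡_; _≢_; refl; cong; cong₂)
import Relation.Binary.PropositionalEquality as ≡
import Relation.Binary.Reasoning.Setoid as SetoidReasoning

insertions-↭ : ∀ {x xs ys} → ys ∈ insertions x xs → ys ↭ x ∷ xs
insertions-↭ {xs = []}    (here refl) = ↭-refl
insertions-↭ {xs = _ ∷ _} (here refl) = ↭-refl
insertions-↭ {x} {y ∷ _} (there p) with ∈-map⁻ (y ∷_) p
... | zs , zs∈ , refl = ↭-trans (prep y (insertions-↭ zs∈)) (swap y x ↭-refl)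

∈-insertions : ∀ x as bs → as ++ x ∷ bs ∈ insertions x (as ++ bs)
∈-insertions x []       []      = here refl
∈-insertions x []       (_ ∷ _) = here refl
∈-insertions x (a ∷ as) bs      = there (∈-map⁺ (a ∷_) (∈-insertions x as bs))

∈-permutations⁻ : ∀ μ {c} → c ∈ permutations μ → c ↭ μ
∈-permutations⁻ []       (here refl) = ↭-refl
∈-permutations⁻ (x ∷ xs) c∈ with find (∈-concatMap⁻ (insertions x) {xs = permutations xs} c∈)
... | d , d∈ , c∈insertions = ↭-trans (insertions-↭ c∈insertions) (prep x (∈-permutations⁻ xs d∈))

∈-permutations⁺ : ∀ μ {c} → c ↭ μ → c ∈ permutations μ
∈-permutations⁺ [] c↭[] with ↭-empty-inv c↭[]
... | refl = here refl
∈-permutations⁺ (x ∷ xs) c↭ with ∈-∃++ (∈-resp-↭ (↭-sym c↭) (here refl))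
... | as , bs , refl =
  ∈-concatMap⁺ (insertions x) (lose (∈-permutations⁺ xs (drop-mid as [] c↭)) (∈-insertions x as bs))

∈-C⁻ : ∀ μ {c} → c ∈ C μ → c ↭ μ
∈-C⁻ μ c∈ = ∈-permutations⁻ μ (∈-deduplicate⁻ (≡-dec ℕ._≟_) (permutations μ) c∈)

∈-C⁺ : ∀ μ {c} → c ↭ μ → c ∈ C μ
∈-C⁺ μ c↭ = ∈-deduplicate⁺ (≡-dec ℕ._≟_) (∈-permutations⁺ μ c↭)

C-unique : ∀ μ → Unique (C μ)
C-unique μ = DecUnique.deduplicate-! (≡-dec ℕ._≟_) (permutations μ)

removeOne-↭ : ∀ {i μ} → i ∈ μ → i ∷ removeOne i μ ↭ μ
removeOne-↭ {i} {x ∷ xs} i∈ with i ℕ.≟ x | i∈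
... | yes refl | _          = ↭-refl
... | no  i≢x  | here i≡x   = ⊥-elim (i≢x i≡x)
... | no  _    | there i∈xs = ↭-trans (swap i x ↭-refl) (prep x (removeOne-↭ i∈xs))

size-removeOne : ∀ {i μ} → i ∈ μ → i ℕ.+ size (removeOne i μ) ≡ size μ
size-removeOne i∈ = sum-↭ (removeOne-↭ i∈)

size-positive : ∀ {μ} → IsPartition μ → μ ≢ [] → 1 ≤ size μ
size-positive {[]}     _              μ≢[] = ⊥-elim (μ≢[] refl)
size-positive {x ∷ xs} (1≤x ∷ _ , _) _    = ℕ.≤-trans 1≤x (ℕ.m≤m+n x (sum xs))

module _ {A : Set} (F : A → List (List A)) where

  withLast : List A → List (List A)
  withLast = concatMap (λ i → map (_∷ʳ i) (F i))

  ∈-withLast⁻ : ∀ is {c} → c ∈ withLast is → ∃₂ λ i c′ → i ∈ is × c′ ∈ F i × c ≡ c′ ∷ʳ i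
  ∈-withLast⁻ is c∈ with find (∈-concatMap⁻ (λ i → map (_∷ʳ i) (F i)) {xs = is} c∈)
  ... | i , i∈ , c∈F with ∈-map⁻ (_∷ʳ i) c∈F
  ... | c′ , c′∈ , refl = i , c′ , i∈ , c′∈ , refl

  ∈-withLast⁺ : ∀ {is i c′} → i ∈ is → c′ ∈ F i → c′ ∷ʳ i ∈ withLast is
  ∈-withLast⁺ i∈ c′∈ = ∈-concatMap⁺ (λ i → map (_∷ʳ i) (F i)) (lose i∈ (∈-map⁺ _ c′∈))

  withLast-unique : (∀ i → Unique (F i)) → ∀ {is} → Unique is → Unique (withLast is)
  withLast-unique F-unique {[]}     []           = []
  withLast-unique F-unique {i ∷ is} (i∉is ∷ is!) =
    Unique.++⁺ (Unique.map⁺ (∷ʳ-injectiveˡ _ _) (F-unique i))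
               (withLast-unique F-unique is!)
               disjoint
    where
    disjoint : ∀ {c} → c ∈ map (_∷ʳ i) (F i) × c ∈ withLast is → ⊥
    disjoint (c∈ , c∈′) with ∈-map⁻ (_∷ʳ i) c∈ | ∈-withLast⁻ is c∈′
    ... | c′ , _ , refl | j , c″ , j∈ , _ , eq = All.lookup i∉is j∈ (∷ʳ-injectiveʳ c′ c″ eq)

C-byLastPart : ∀ μ → μ ≢ [] → C μ ↭ withLast (λ i → C (removeOne i μ)) (distinctParts μ)
C-byLastPart μ μ≢[] = ∼bag⇒↭ (unique∧set⇒bag
  (C-unique μ)
  (withLast-unique _ (λ i → C-unique (removeOne i μ)) (DecUnique.deduplicate-! ℕ._≟_ μ))
  (mk⇔ splitLast joinLast))
  where
  splitLast : ∀ {c} → c ∈ C μ → c ∈ withLast (λ i → C (removeOne i μ)) (distinctParts μ)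
  splitLast {c} c∈ with initLast c
  ... | [] = ⊥-elim (μ≢[] (↭-empty-inv (↭-sym (∈-C⁻ μ c∈))))
  ... | c′ ∷ʳ′ i = ∈-withLast⁺ _ (∈-deduplicate⁺ ℕ._≟_ i∈μ) (∈-C⁺ _ c′↭)
    where
    i∷c′↭μ : i ∷ c′ ↭ μ
    i∷c′↭μ = ↭-trans (∷↭∷ʳ i c′) (∈-C⁻ μ c∈)
    i∈μ : i ∈ μ
    i∈μ = ∈-resp-↭ i∷c′↭μ (here refl)
    c′↭ : c′ ↭ removeOne i μ
    c′↭ = drop-∷ (↭-trans i∷c′↭μ (↭-sym (removeOne-↭ i∈μ)))

  joinLast : ∀ {c} → c ∈ withLast (λ i → C (removeOne i μ)) (distinctParts μ) → c ∈ C μ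
  joinLast c∈ with ∈-withLast⁻ _ (distinctParts μ) c∈
  ... | i , c′ , i∈ , c′∈ , refl = ∈-C⁺ μ (↭-trans (↭-sym (∷↭∷ʳ i c′))
    (↭-trans (prep i (∈-C⁻ _ c′∈)) (removeOne-↭ (∈-deduplicate⁻ ℕ._≟_ μ i∈))))

module RingSums {c ℓ} (R : CommutativeRing c ℓ) where
  open CommutativeRing R renaming (refl to ≈-refl)
  open WithRing R
  open SetoidReasoning setoid

  Σ-cong : ∀ {A : Set} {f g : A → Carrier} xs → (∀ {x} → x ∈ xs → f x ≈ g x) →
           Σ (map f xs) ≈ Σ (map g xs)
  Σ-cong []       f≈g = ≈-refl
  Σ-cong (x ∷ xs) f≈g = +-cong (f≈g (here refl)) (Σ-cong xs (λ x∈ → f≈g (there x∈)))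

  Σ-↭ : ∀ {A : Set} (f : A → Carrier) {xs ys} → xs ↭ ys → Σ (map f xs) ≈ Σ (map f ys)
  Σ-↭ f xs↭ys = SetoidPermutation.foldr-commMonoid setoid +-isCommutativeMonoid
    (↭⇒↭ₛ′ isEquivalence (map⁺ f xs↭ys))

  Σ-++ : ∀ {A : Set} (f : A → Carrier) xs ys → Σ (map f (xs ++ ys)) ≈ Σ (map f xs) + Σ (map f ys)
  Σ-++ f []       ys = sym (+-identityˡ _)
  Σ-++ f (x ∷ xs) ys = trans (+-congˡ (Σ-++ f xs ys)) (sym (+-assoc _ _ _))

  Σ-concatMap : ∀ {A B : Set} (f : B → Carrier) (g : A → List B) xs →
                Σ (map f (concatMap g xs)) ≈ Σ (map (λ x → Σ (map f (g x))) xs)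
  Σ-concatMap f g []       = ≈-refl
  Σ-concatMap f g (x ∷ xs) = trans (Σ-++ f (g x) (concatMap g xs)) (+-congˡ (Σ-concatMap f g xs))

  *-distribˡ-Σ : ∀ {A : Set} (f : A → Carrier) k xs → k * Σ (map f xs) ≈ Σ (map (λ x → k * f x) xs)
  *-distribˡ-Σ f k []       = zeroʳ k
  *-distribˡ-Σ f k (x ∷ xs) = trans (distribˡ k _ _) (+-congˡ (*-distribˡ-Σ f k xs))

  *-distribʳ-Σ : ∀ {A : Set} (f : A → Carrier) k xs → Σ (map f xs) * k ≈ Σ (map (λ x → f x * k) xs)
  *-distribʳ-Σ f k []       = zeroˡ k
  *-distribʳ-Σ f k (x ∷ xs) = trans (distribʳ k _ _) (+-congˡ (*-distribʳ-Σ f k xs))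

  cancel-inverse : ∀ x y z w → x * y ≈ 1# → x * (z * (w * y)) ≈ w * z
  cancel-inverse x y z w xy≈1 = begin
    x * (z * (w * y)) ≈⟨ *-congˡ (*-congˡ (*-comm w y)) ⟩
    x * (z * (y * w)) ≈⟨ *-congˡ (*-comm z (y * w)) ⟩
    x * ((y * w) * z) ≈⟨ sym (*-assoc x (y * w) z) ⟩
    (x * (y * w)) * z ≈⟨ *-congʳ (sym (*-assoc x y w)) ⟩
    ((x * y) * w) * z ≈⟨ *-congʳ (*-congʳ xy≈1) ⟩
    (1# * w) * z      ≈⟨ *-congʳ (*-identityˡ w) ⟩
    w * z             ∎

module LastPart {c ℓ} (R : CommutativeRing c ℓ) (a b q : CommutativeRing.Carrier R)
                 (inv : ℕ → CommutativeRing.Carrier R) where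
  open CommutativeRing R
  open WithRing R
  open Z a b q inv
  open RingSums R
  open SetoidReasoning setoid

  lastFactor : ℕ → ℕ → ℕ → Carrier
  lastFactor i s n = (pow a i * pow q s - pow b i) * inv n

  term-∷ʳ : ∀ s xs i →
            term s (xs ∷ʳ i) ≈ term s xs * lastFactor i (s ℕ.+ sum xs) (s ℕ.+ sum xs ℕ.+ i)
  term-∷ʳ s []       i = trans (*-comm _ 1#)
    (*-congˡ (reflexive (cong (λ t → lastFactor i t (t ℕ.+ i)) (≡.sym (ℕ.+-identityʳ s)))))
  term-∷ʳ s (x ∷ xs) i = trans (*-congˡ (term-∷ʳ (s ℕ.+ x) xs i)) (trans (sym (*-assoc _ _ _))
    (*-congˡ (reflexive (cong (λ t → lastFactor i t (t ℕ.+ i)) (ℕ.+-assoc s x (sum xs))))))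

  Σ-endingIn : ∀ {i μ} → i ∈ μ →
               Σ (map (term 0) (map (_∷ʳ i) (C (removeOne i μ))))
               ≈ Zμ (removeOne i μ) * lastFactor i (size μ ℕ.∸ i) (size μ)
  Σ-endingIn {i} {μ} i∈μ = begin
    Σ (map (term 0) (map (_∷ʳ i) (C μ∖i)))    ≡⟨ cong Σ (≡.sym (map-∘ (C μ∖i))) ⟩
    Σ (map (λ c′ → term 0 (c′ ∷ʳ i)) (C μ∖i)) ≈⟨ Σ-cong (C μ∖i) last ⟩
    Σ (map (λ c′ → term 0 c′ * L) (C μ∖i))    ≈⟨ *-distribʳ-Σ (term 0) L (C μ∖i) ⟨
    Zμ μ∖i * L                                 ∎
    where
    μ∖i : List ℕ
    μ∖i = removeOne i μ
    L : Carrier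
    L = lastFactor i (size μ ℕ.∸ i) (size μ)
    i+|μ∖i|≡|μ| : i ℕ.+ size μ∖i ≡ size μ
    i+|μ∖i|≡|μ| = size-removeOne i∈μ
    last : ∀ {c′} → c′ ∈ C μ∖i → term 0 (c′ ∷ʳ i) ≈ term 0 c′ * L
    last {c′} c′∈ = trans (term-∷ʳ 0 c′ i) (*-congˡ (reflexive (cong₂ (lastFactor i) before after)))
      where
      |c′|≡|μ∖i| : sum c′ ≡ size μ∖i
      |c′|≡|μ∖i| = sum-↭ (∈-C⁻ μ∖i c′∈)
      before : sum c′ ≡ size μ ℕ.∸ i
      before = ≡.trans |c′|≡|μ∖i|
        (≡.trans (≡.sym (ℕ.m+n∸m≡n i (size μ∖i))) (cong (ℕ._∸ i) i+|μ∖i|≡|μ|))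
      after : sum c′ ℕ.+ i ≡ size μ
      after = ≡.trans (cong (ℕ._+ i) |c′|≡|μ∖i|) (≡.trans (ℕ.+-comm (size μ∖i) i) i+|μ∖i|≡|μ|)

  Zμ-byLastPart : ∀ μ → μ ≢ [] →
                  Zμ μ ≈ Σ (map (λ i → Zμ (removeOne i μ) * lastFactor i (size μ ℕ.∸ i) (size μ))
                                (distinctParts μ))
  Zμ-byLastPart μ μ≢[] = begin
    Σ (map (term 0) (C μ))
      ≈⟨ Σ-↭ (term 0) (C-byLastPart μ μ≢[]) ⟩
    Σ (map (term 0) (withLast (λ i → C (removeOne i μ)) (distinctParts μ)))
      ≈⟨ Σ-concatMap (term 0) (λ i → map (_∷ʳ i) (C (removeOne i μ))) (distinctParts μ) ⟩
    Σ (map (λ i → Σ (map (term 0) (map (_∷ʳ i) (C (removeOne i μ))))) (distinctParts μ))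
      ≈⟨ Σ-cong (distinctParts μ) (λ i∈ → Σ-endingIn (∈-deduplicate⁻ ℕ._≟_ μ i∈)) ⟩
    Σ (map (λ i → Zμ (removeOne i μ) * lastFactor i (size μ ℕ.∸ i) (size μ)) (distinctParts μ)) ∎

proposition3 : ∀ {c ℓ} (R : CommutativeRing c ℓ) →
    let open CommutativeRing R
        open WithRing R
    in (a b q : Carrier) (inv : ℕ → Carrier) →
       (∀ k → 1 ≤ k → ((1# - pow q k) * inv k ≈ 1#) × (inv k * (1# - pow q k) ≈ 1#)) →
       (μ : List ℕ) → IsPartition μ → μ ≢ [] →
       let open Z a b q inv
       in (1# - pow q (size μ)) * Zμ μ
          ≈ Σ (map (λ i → ((pow a i * pow q (size μ Data.Nat.∸ i)) - pow b i) * Zμ (removeOne i μ))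
                   (distinctParts μ))
proposition3 R a b q inv inverse μ μ-partition μ≢[] = begin
  (1# - pow q n) * Zμ μ
    ≈⟨ *-congˡ (Zμ-byLastPart μ μ≢[]) ⟩
  (1# - pow q n) * Σ (map (λ i → Zμ (removeOne i μ) * lastFactor i (n ℕ.∸ i) n) (distinctParts μ))
    ≈⟨ *-distribˡ-Σ _ (1# - pow q n) (distinctParts μ) ⟩
  Σ (map (λ i → (1# - pow q n) * (Zμ (removeOne i μ) * lastFactor i (n ℕ.∸ i) n)) (distinctParts μ))
    ≈⟨ Σ-cong (distinctParts μ) (λ _ → cancel-inverse _ (inv n) _ _ (proj₁ (inverse n 1≤n))) ⟩
  Σ (map (λ i → (pow a i * pow q (n ℕ.∸ i) - pow b i) * Zμ (removeOne i μ)) (distinctParts μ)) ∎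
  where
  open CommutativeRing R
  open WithRing R
  open Z a b q inv
  open RingSums R
  open LastPart R a b q inv
  open SetoidReasoning setoid
  n : ℕ
  n = size μ
  1≤n : 1 ≤ n
  1≤n = size-positive μ-partition μ≢[]
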